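{- If $H$ is a snipped subgraph of a finite simple graph $G$, then $d(H)\le d(G)$.
   Context: The jump graph $J(G)$ has vertex set $E(G)$, two vertices adjacent iff the corresponding edges of $G$ share no endpoint; $J^0(G)=G$, $J^k(G)=J(J^{k-1}(G))$. The dissipation number $d(G)$ is the smallest $k\ge0$ with $J^k(G)$ the empty graph (no vertices), or $\infty$ if none exists. A quotient graph $Q$ of $G$ is obtained from a partition of $V(G)$: its vertices are the classes $[v]$, and $\{[u],[v]\}\in E(Q)$ iff $[u]\neq[v]$ and there is an edge $\{u',v'\}\in E(G)$ with $u'\in[u]$, $v'\in[v]$ (so loops and multiple edges are removed). A snipped subgraph of $G$ is a quotient graph of a subgraph of $G$. -}

module Defs where

open import Data.Nat using (ℕ; zero; suc; _≤_; _<_)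
open import Data.Bool using (Bool; true; false; _∧_; not; _∨_)
open import Data.Fin using (Fin; _<?_)
open import Data.Fin.Properties using (_≟_)
open import Data.List using (List; []; _∷_; length; filter; allFin; concatMap; map; lookup)
open import Data.Product using (Σ; _×_; _,_; proj₁; proj₂; ∃; ∃-syntax)
open import Relation.Binary.PropositionalEquality using (_≡_; _≢_)
open import Relation.Nullary using (¬_)
open import Relation.Nullary.Decidable using (⌊_⌋)
open import Function using (Injective; Surjective; _∘_)

record Graph : Set where
  constructor mkGraph
  field
    n   : ℕ
    adj : Fin n → Fin n → Bool
open Graph public

record IsSimple (G : Graph) : Set where
  field
    symm    : ∀ i j → adj G i j ≡ adj G j i
    irrefl  : ∀ i → adj G i i ≡ false

edges : (G : Graph) → List (Fin (n G) × Fin (n G))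
edges G = filter (λ p → Data.Bool._≟_ (adj G (proj₁ p) (proj₂ p) ∧ ⌊ proj₁ p <? proj₂ p ⌋) true)
            (concatMap (λ i → map (λ j → (i , j)) (allFin (n G))) (allFin (n G)))

disjoint : ∀ {k} → Fin k × Fin k → Fin k × Fin k → Bool
disjoint (a , b) (c , d) =
  not (⌊ a ≟ c ⌋ ∨ ⌊ a ≟ d ⌋ ∨ ⌊ b ≟ c ⌋ ∨ ⌊ b ≟ d ⌋)

J : Graph → Graph
J G = mkGraph (length (edges G))
              (λ e f → disjoint (lookup (edges G) e) (lookup (edges G) f))

J^ : ℕ → Graph → Graph
J^ zero    G = G
J^ (suc k) G = J (J^ k G)

IsEmptyGraph : Graph → Set
IsEmptyGraph G = n G ≡ 0

-- d(G) = k : k is the least index with J^k(G) empty.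
-- (d(G) = ∞ iff there is no such k.)
HasDissipationNumber : Graph → ℕ → Set
HasDissipationNumber G k =
  IsEmptyGraph (J^ k G) × (∀ j → j < k → ¬ IsEmptyGraph (J^ j G))

IsSubgraph : Graph → Graph → Set
IsSubgraph S G =
  Σ (Fin (n S) → Fin (n G)) λ ι →
    Injective _≡_ _≡_ ι × (∀ a b → adj S a b ≡ true → adj G (ι a) (ι b) ≡ true)

-- Q is a quotient graph of S (up to relabelling): a surjection π from V(S)
-- onto V(Q) (its fibres are the partition classes) such that
-- x ~ y in Q iff x ≢ y and some edge {a , b} of S has π a ≡ x, π b ≡ y.
IsQuotient : Graph → Graph → Set
IsQuotient Q S =
  Σ (Fin (n S) → Fin (n Q)) λ π →
    Surjective _≡_ _≡_ π ×
    (∀ x y → (adj Q x y ≡ true) Function.⇔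
              (x ≢ y × ∃[ a ] ∃[ b ] (π a ≡ x × π b ≡ y × adj S a b ≡ true)))

IsSnipped : Graph → Graph → Set
IsSnipped H G = ∃[ S ] (IsSimple S × IsSubgraph S G × IsQuotient H S)

{-# OPTIONS --safe #-}
-- A snipped subgraph H of G comes with a partial map from V(G) onto V(H)
-- (a vertex of S ⊆ G goes to its class) under which every edge of H is the
-- image of an edge of G.  Sending each edge of H to such a preimage edge
-- embeds J(H) into J(G): preimages of edges with disjoint endpoints have
-- disjoint endpoints, and an edge is recovered from its preimage.  An
-- embedding is again such a map, so J^k(H) embeds into J^k(G) for every k,
-- and J^k(G) empty forces J^k(H) empty.
module Submission where

open import Defs
open import Data.Nat using (ℕ; _≤_)
open import Data.Product using (_×_; ∃-syntax)

open import Data.Nat using (zero; suc; _+_; _<_)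
open import Data.Nat.Properties using (m≤m+n; +-suc; +-identityʳ; m<1+n⇒m<n∨m≡n)
import Data.Nat.Properties as ℕ
open import Data.Bool using (true; _∧_)
open import Data.Bool.Properties using (⇔→≡; T-≡)
open import Data.Fin as Fin using (Fin; _<?_)
open import Data.Fin.Properties using (_≟_; <-cmp; <-irrefl; <-asym)
open import Data.List using (List; []; _∷_; _++_; length; map; concatMap; allFin; lookup; cartesianProduct)
open import Data.List.Membership.Propositional using (_∈_)
open import Data.List.Membership.Propositional.Properties
  using (∈-filter⁺; ∈-filter⁻; ∈-cartesianProduct⁺; ∈-allFin; ∈-lookup)
import Data.List.Relation.Unary.All as All
open import Data.List.Relation.Unary.AllPairs using (_∷_)
open import Data.List.Relation.Unary.Any using (index)
open import Data.List.Relation.Unary.Any.Properties using (lookup-index)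
open import Data.List.Relation.Unary.Unique.Propositional using (Unique)
open import Data.List.Relation.Unary.Unique.Propositional.Properties
  using (filter⁺; cartesianProduct⁺; allFin⁺)
open import Data.Product using (_,_; proj₁; proj₂)
open import Data.Sum using (_⊎_; inj₁; inj₂)
open import Data.Empty using (⊥; ⊥-elim)
open import Function using (_∘_)
open import Function.Bundles using (Equivalence; mk⇔)
open import Relation.Binary using (tri<; tri≈; tri>)
open import Relation.Binary.PropositionalEquality
  using (_≡_; refl; sym; trans; cong; cong₂; subst; subst₂)
open import Relation.Nullary using (¬_; yes; no)
open import Relation.Nullary.Decidable using (⌊_⌋; fromWitness; toWitness)
open import Relation.Unary using (Decidable)

SymmetricAdj : Graph → Set
SymmetricAdj G = ∀ i j → adj G i j ≡ adj G j i

Incident : ∀ {k} → Fin k × Fin k → Fin k → Set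
Incident p w = proj₁ p ≡ w ⊎ proj₂ p ≡ w

Separated : ∀ {k} → Fin k × Fin k → Fin k × Fin k → Set
Separated p q = ∀ {w} → Incident p w → Incident q w → ⊥

disjoint⇒separated : ∀ {k} (p q : Fin k × Fin k) → disjoint p q ≡ true → Separated p q
disjoint⇒separated (a , b) (c , d) eq i j with a ≟ c | a ≟ d | b ≟ c | b ≟ d
disjoint⇒separated (a , b) (c , d) () i j | yes _ | _ | _ | _
disjoint⇒separated (a , b) (c , d) () i j | no _ | yes _ | _ | _
disjoint⇒separated (a , b) (c , d) () i j | no _ | no _ | yes _ | _
disjoint⇒separated (a , b) (c , d) () i j | no _ | no _ | no _ | yes _
disjoint⇒separated (a , b) (c , d) _ (inj₁ refl) (inj₁ refl) | no a≢c | no _ | no _ | no _ = a≢c refl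
disjoint⇒separated (a , b) (c , d) _ (inj₁ refl) (inj₂ refl) | no _ | no a≢d | no _ | no _ = a≢d refl
disjoint⇒separated (a , b) (c , d) _ (inj₂ refl) (inj₁ refl) | no _ | no _ | no b≢c | no _ = b≢c refl
disjoint⇒separated (a , b) (c , d) _ (inj₂ refl) (inj₂ refl) | no _ | no _ | no _ | no b≢d = b≢d refl

separated⇒disjoint : ∀ {k} (p q : Fin k × Fin k) → Separated p q → disjoint p q ≡ true
separated⇒disjoint (a , b) (c , d) sep with a ≟ c | a ≟ d | b ≟ c | b ≟ d
... | yes a≡c | _ | _ | _ = ⊥-elim (sep (inj₁ refl) (inj₁ (sym a≡c)))
... | no _ | yes a≡d | _ | _ = ⊥-elim (sep (inj₁ refl) (inj₂ (sym a≡d)))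
... | no _ | no _ | yes b≡c | _ = ⊥-elim (sep (inj₂ refl) (inj₁ (sym b≡c)))
... | no _ | no _ | no _ | yes b≡d = ⊥-elim (sep (inj₂ refl) (inj₂ (sym b≡d)))
... | no _ | no _ | no _ | no _ = refl

disjoint-sym : ∀ {k} (p q : Fin k × Fin k) → disjoint p q ≡ disjoint q p
disjoint-sym p q = ⇔→≡ {z = true} (mk⇔ (flip-disjoint p q) (flip-disjoint q p))
  where
  flip-disjoint : ∀ p q → disjoint p q ≡ true → disjoint q p ≡ true
  flip-disjoint p q eq = separated⇒disjoint q p λ i j → disjoint⇒separated p q eq j i

J-symmetric : ∀ G → SymmetricAdj (J G)
J-symmetric G e f = disjoint-sym (lookup (edges G) e) (lookup (edges G) f)

J^-symmetric : ∀ {G} → SymmetricAdj G → ∀ m → SymmetricAdj (J^ m G)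
J^-symmetric symm zero    = symm
J^-symmetric symm (suc m) = J-symmetric (J^ m _)

concatMap-pairs≡cartesianProduct : ∀ {A B : Set} (xs : List A) (ys : List B) →
  concatMap (λ i → map (λ j → (i , j)) ys) xs ≡ cartesianProduct xs ys
concatMap-pairs≡cartesianProduct []       ys = refl
concatMap-pairs≡cartesianProduct (x ∷ xs) ys =
  cong (map (x ,_) ys ++_) (concatMap-pairs≡cartesianProduct xs ys)

module _ (G : Graph) where

  private
    IsEdge : Fin (n G) × Fin (n G) → Set
    IsEdge (x , y) = (adj G x y ∧ ⌊ x <? y ⌋) ≡ true

    IsEdge? : Decidable IsEdge
    IsEdge? (x , y) = Data.Bool._≟_ (adj G x y ∧ ⌊ x <? y ⌋) true

    pairs : List (Fin (n G) × Fin (n G))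
    pairs = concatMap (λ i → map (λ j → (i , j)) (allFin (n G))) (allFin (n G))

    pairs≡cartesianProduct : pairs ≡ cartesianProduct (allFin (n G)) (allFin (n G))
    pairs≡cartesianProduct = concatMap-pairs≡cartesianProduct (allFin (n G)) (allFin (n G))

  ∈-edges⁺ : ∀ {x y} → adj G x y ≡ true → x Fin.< y → (x , y) ∈ edges G
  ∈-edges⁺ {x} {y} x~y x<y =
    ∈-filter⁺ IsEdge?
      (subst ((x , y) ∈_) (sym pairs≡cartesianProduct)
        (∈-cartesianProduct⁺ (∈-allFin x) (∈-allFin y)))
      (cong₂ _∧_ x~y (Equivalence.to T-≡ (fromWitness x<y)))

  ∈-edges⁻ : ∀ {x y} → (x , y) ∈ edges G → adj G x y ≡ true × x Fin.< y
  ∈-edges⁻ {x} {y} xy∈ with adj G x y | proj₂ (∈-filter⁻ IsEdge? {xs = pairs} xy∈)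
  ... | true | x<y = refl , toWitness (Equivalence.from T-≡ x<y)

  edges-unique : Unique (edges G)
  edges-unique = filter⁺ IsEdge?
    (subst Unique (sym pairs≡cartesianProduct) (cartesianProduct⁺ (allFin⁺ (n G)) (allFin⁺ (n G))))

lookup-injective : ∀ {A : Set} {xs : List A} → Unique xs →
  ∀ i j → lookup xs i ≡ lookup xs j → i ≡ j
lookup-injective {xs = _ ∷ _} _         Fin.zero    Fin.zero    _  = refl
lookup-injective {xs = _ ∷ _} (x≢ ∷ _) Fin.zero    (Fin.suc j) eq = ⊥-elim (All.lookup x≢ (∈-lookup j) eq)
lookup-injective {xs = _ ∷ _} (x≢ ∷ _) (Fin.suc i) Fin.zero    eq = ⊥-elim (All.lookup x≢ (∈-lookup i) (sym eq))
lookup-injective {xs = _ ∷ _} (_ ∷ u)  (Fin.suc i) (Fin.suc j) eq = cong Fin.suc (lookup-injective u i j eq)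

-- A partial surjection V(B) ⇀ V(A), given as its graph `Over w x` (w ↦ x),
-- along which every edge of A lifts to an edge of B.
record Snipping (A B : Graph) : Set₁ where
  field
    Over            : Fin (n B) → Fin (n A) → Set
    over-functional : ∀ {w x x′} → Over w x → Over w x′ → x ≡ x′
    over-surjective : ∀ x → ∃[ w ] Over w x
    edge-lift       : ∀ {x y} → adj A x y ≡ true →
                      ∃[ u ] ∃[ v ] (Over u x × Over v y × adj B u v ≡ true)

subgraph⇒snipping : ∀ {A B} → IsSubgraph A B → Snipping A B
subgraph⇒snipping (ι , ι-injective , ι-adj) = record
  { Over            = λ w x → ι x ≡ w
  ; over-functional = λ ιx≡w ιx′≡w → ι-injective (trans ιx≡w (sym ιx′≡w))
  ; over-surjective = λ x → ι x , refl
  ; edge-lift       = λ {x} {y} x~y → ι x , ι y , refl , refl , ι-adj x y x~y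
  }

snipped⇒snipping : ∀ {H G} → IsSnipped H G → Snipping H G
snipped⇒snipping (_ , _ , (ι , ι-injective , ι-adj) , (π , π-surjective , π-adj)) = record
  { Over            = λ w x → ∃[ a ] (ι a ≡ w × π a ≡ x)
  ; over-functional = λ (a , ιa≡w , πa≡x) (a′ , ιa′≡w , πa′≡x′) →
      trans (sym πa≡x) (trans (cong π (ι-injective (trans ιa≡w (sym ιa′≡w)))) πa′≡x′)
  ; over-surjective = λ x → let (a , πa≡x) = π-surjective x in ι a , a , refl , πa≡x refl
  ; edge-lift       = λ {x} {y} x~y →
      let (_ , a , b , πa≡x , πb≡y , a~b) = Equivalence.to (π-adj x y) x~y
      in ι a , ι b , (a , refl , πa≡x) , (b , refl , πb≡y) , ι-adj a b a~b
  }

snipping-reflects-empty : ∀ {A B} → Snipping A B → IsEmptyGraph B → IsEmptyGraph A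
snipping-reflects-empty σ nB≡0 =
  empty-domain (λ x → subst Fin nB≡0 (proj₁ (Snipping.over-surjective σ x)))
  where
  empty-domain : ∀ {m} → (Fin m → Fin 0) → m ≡ 0
  empty-domain {zero}  _ = refl
  empty-domain {suc _} f with f Fin.zero
  ... | ()

module _ {A B : Graph} (B-symmetric : SymmetricAdj B) (σ : Snipping A B) where
  open Snipping σ

  LiesOver : Fin (n B) × Fin (n B) → Fin (n A) × Fin (n A) → Set
  LiesOver (u , v) (x , y) = (Over u x × Over v y) ⊎ (Over u y × Over v x)

  over-incident : ∀ {q p w} → LiesOver q p → Incident q w → ∃[ x ] (Over w x × Incident p x)
  over-incident (inj₁ (ux , _)) (inj₁ refl) = _ , ux , inj₁ refl
  over-incident (inj₁ (_ , vy)) (inj₂ refl) = _ , vy , inj₂ refl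
  over-incident (inj₂ (uy , _)) (inj₁ refl) = _ , uy , inj₂ refl
  over-incident (inj₂ (_ , vx)) (inj₂ refl) = _ , vx , inj₁ refl

  lies-over-separated : ∀ {q q′ p p′} → LiesOver q p → LiesOver q′ p′ →
    Separated p p′ → Separated q q′
  lies-over-separated q/p q′/p′ sep i i′ =
    let (x , wx , px) = over-incident q/p i
        (x′ , wx′ , p′x′) = over-incident q′/p′ i′
    in sep px (subst (Incident _) (sym (over-functional wx wx′)) p′x′)

  lies-over-injective : ∀ {q p p′} → LiesOver q p → LiesOver q p′ →
    proj₁ p Fin.< proj₂ p → proj₁ p′ Fin.< proj₂ p′ → p ≡ p′
  lies-over-injective (inj₁ (ux , vy)) (inj₁ (ux′ , vy′)) _ _ =
    cong₂ _,_ (over-functional ux ux′) (over-functional vy vy′)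
  lies-over-injective (inj₂ (uy , vx)) (inj₂ (uy′ , vx′)) _ _ =
    cong₂ _,_ (over-functional vx vx′) (over-functional uy uy′)
  lies-over-injective (inj₁ (ux , vy)) (inj₂ (uy′ , vx′)) x<y x′<y′ =
    ⊥-elim (<-asym x′<y′ (subst₂ Fin._<_ (over-functional ux uy′) (over-functional vy vx′) x<y))
  lies-over-injective (inj₂ (uy , vx)) (inj₁ (ux′ , vy′)) x<y x′<y′ =
    ⊥-elim (<-asym x′<y′ (subst₂ Fin._<_ (over-functional vx vy′) (over-functional uy ux′) x<y))

  edge-over : ∀ {u v x y} → Over u x → Over v y → x Fin.< y → adj B u v ≡ true →
    ∃[ f ] LiesOver (lookup (edges B) f) (x , y)
  edge-over {u} {v} ux vy x<y u~v with <-cmp u v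
  ... | tri< u<v _ _ = index uv∈ , subst (λ q → LiesOver q _) (lookup-index uv∈) (inj₁ (ux , vy))
    where uv∈ = ∈-edges⁺ B u~v u<v
  ... | tri≈ _ refl _ = ⊥-elim (<-irrefl (over-functional ux vy) x<y)
  ... | tri> _ _ v<u = index vu∈ , subst (λ q → LiesOver q _) (lookup-index vu∈) (inj₂ (vy , ux))
    where vu∈ = ∈-edges⁺ B (trans (B-symmetric v u) u~v) v<u

  J-subgraph : IsSubgraph (J A) (J B)
  J-subgraph = proj₁ ∘ lift , injective , preserves-adj
    where
    edge : Fin (length (edges A)) → Fin (n A) × Fin (n A)
    edge = lookup (edges A)

    edge-ordered : ∀ e → proj₁ (edge e) Fin.< proj₂ (edge e)
    edge-ordered e = proj₂ (∈-edges⁻ A (∈-lookup e))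

    lift : ∀ e → ∃[ f ] LiesOver (lookup (edges B) f) (edge e)
    lift e =
      let (u , v , ux , vy , u~v) = edge-lift (proj₁ (∈-edges⁻ A (∈-lookup e)))
      in edge-over ux vy (edge-ordered e) u~v

    injective : ∀ {e e′} → proj₁ (lift e) ≡ proj₁ (lift e′) → e ≡ e′
    injective {e} {e′} f≡f′ = lookup-injective (edges-unique A) e e′
      (lies-over-injective (proj₂ (lift e))
        (subst (λ f → LiesOver (lookup (edges B) f) (edge e′)) (sym f≡f′) (proj₂ (lift e′)))
        (edge-ordered e) (edge-ordered e′))

    preserves-adj : ∀ e e′ → adj (J A) e e′ ≡ true →
      adj (J B) (proj₁ (lift e)) (proj₁ (lift e′)) ≡ true
    preserves-adj e e′ e∥e′ = separated⇒disjoint _ _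
      (lies-over-separated (proj₂ (lift e)) (proj₂ (lift e′))
        (disjoint⇒separated (edge e) (edge e′) e∥e′))

J^-snipping : ∀ {H G} → SymmetricAdj G → Snipping H G → ∀ m → Snipping (J^ m H) (J^ m G)
J^-snipping symm σ zero    = σ
J^-snipping symm σ (suc m) =
  subgraph⇒snipping (J-subgraph (J^-symmetric symm m) (J^-snipping symm σ m))

module _ {P : ℕ → Set} (P? : Decidable P) where

  least-witness-from : ∀ m d → (∀ i → i < m → ¬ P i) → P (m + d) →
    ∃[ j ] (j ≤ m + d × P j × (∀ i → i < j → ¬ P i))
  least-witness-from m d below p with P? m
  ... | yes pm = m , m≤m+n m d , pm , below
  least-witness-from m zero    below p | no ¬pm = ⊥-elim (¬pm (subst P (+-identityʳ m) p))
  least-witness-from m (suc d) below p | no ¬pm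
    with least-witness-from (suc m) d below′ (subst P (+-suc m d) p)
    where
    below′ : ∀ i → i < suc m → ¬ P i
    below′ i i<1+m with m<1+n⇒m<n∨m≡n i<1+m
    ... | inj₁ i<m  = below i i<m
    ... | inj₂ refl = ¬pm
  ... | j , j≤ , pj , least = j , subst (j ≤_) (sym (+-suc m d)) j≤ , pj , least

  least-witness : ∀ k → P k → ∃[ j ] (j ≤ k × P j × (∀ i → i < j → ¬ P i))
  least-witness k = least-witness-from 0 k λ _ ()

mainTheorem5 : (G H : Graph) → IsSimple G → IsSnipped H G →
    (k : ℕ) → HasDissipationNumber G k →
    ∃[ j ] (j ≤ k × HasDissipationNumber H j)
mainTheorem5 G H simple snipped k (J^kG-empty , _) =
  least-witness (λ j → n (J^ j H) ℕ.≟ 0) k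
    (snipping-reflects-empty
      (J^-snipping (IsSimple.symm simple) (snipped⇒snipping snipped) k) J^kG-empty)
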